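{- Let $G$ be a finite simple undirected graph, let $V_k\subseteq V(G)$ be a vertex cover of $G$ with $|V_k|=k$, and let $M=M(G,V_k)$ be the graph obtained from $G$ by adding, for each non-empty subset $X\subseteq V_k$, a new vertex $M_X$ whose neighborhood is exactly $X$. Fix a partition of $V_k$ into four non-empty sets $A$, $P_1$, $P_2$, $P_3$. Then there is at most one free potential maximal clique $\Omega$ of $M$ such that $P(\Omega)=\{A,P_1,P_2,P_3\}$, i.e., such that $V_k\cap\Omega=A$ and the non-empty sets $V_k\cap C$, over connected components $C$ of $M\setminus\Omega$, are exactly $P_1$, $P_2$, $P_3$.
   Context: A vertex cover is a vertex set meeting every edge. For $\Omega\subseteq V(M)$, $M\setminus\Omega$ is the subgraph induced by $V(M)\setminus\Omega$. A triangulation of $M$ is a chordal graph on $V(M)$ containing $E(M)$; it is minimal if no triangulation has an edge set that is a proper subset of its edge set. A potential maximal clique (PMC) of $M$ is a maximal clique of some minimal triangulation of $M$. A PMC $\Omega$ is free if every vertex of $\Omega$ is adjacent to some vertex of $V(M)\setminus\Omega$. For a PMC $\Omega$ of $M$, $P(\Omega)$ is the partition of $V_k$ whose parts are $V_k\cap\Omega$ (if non-empty) together with the non-empty sets $V_k\cap C$ for the connected components $C$ of $M\setminus\Omega$. -}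

module Defs where

open import Data.Nat using (ℕ; zero; suc; _≤_)
open import Data.Fin using (Fin; toℕ)
open import Data.Fin.Subset using (Subset; _∈_; _⊆_; _∪_; _∩_; Empty; Nonempty; ∣_∣)
open import Data.Fin.Subset.Properties using (_⊆?_; nonempty?)
open import Data.Bool using (Bool; true; false; T)
open import Data.Vec using (lookup)
open import Data.Product using (Σ; ∃; ∃-syntax; _×_; _,_)
open import Data.Sum using (_⊎_; inj₁; inj₂)
open import Data.Empty using (⊥)
open import Relation.Nullary using (¬_)
open import Relation.Nullary.Decidable using (True)
open import Relation.Binary.PropositionalEquality using (_≡_; _≢_)
open import Function.Definitions using (Injective)
open import Function.Bundles using (_⇔_)

VSet : Set → Set
VSet V = V → Bool

Rel : Set → Set
Rel V = V → V → Bool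

IsSimple : {V : Set} → Rel V → Set
IsSimple {V} H = (∀ (u v : V) → H u v ≡ H v u) × (∀ (v : V) → H v v ≡ false)

_⊆E_ : {V : Set} → Rel V → Rel V → Set
_⊆E_ {V} H H' = ∀ (u v : V) → T (H u v) → T (H' u v)

Consec : (m : ℕ) → Fin m → Fin m → Set
Consec m i j = (suc (toℕ i) ≡ toℕ j) ⊎ ((suc (toℕ i) ≡ m) × (toℕ j ≡ 0))

IsCycle : {V : Set} → Rel V → (m : ℕ) → (Fin m → V) → Set
IsCycle H m f = Injective _≡_ _≡_ f × (∀ i j → Consec m i j → T (H (f i) (f j)))

HasChord : {V : Set} → Rel V → (m : ℕ) → (Fin m → V) → Set
HasChord H m f =
  ∃[ i ] ∃[ j ] (i ≢ j × ¬ Consec m i j × ¬ Consec m j i × T (H (f i) (f j)))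

Chordal : {V : Set} → Rel V → Set
Chordal H = ∀ (m : ℕ) → 4 ≤ m → (f : Fin m → _) → IsCycle H m f → HasChord H m f

IsTriangulation : {V : Set} → Rel V → Rel V → Set
IsTriangulation E H = IsSimple H × E ⊆E H × Chordal H

IsMinimalTriangulation : {V : Set} → Rel V → Rel V → Set
IsMinimalTriangulation E H =
  IsTriangulation E H ×
  (∀ H' → IsTriangulation E H' → ¬ (H' ⊆E H × ¬ (H ⊆E H')))

_⊆V_ : {V : Set} → VSet V → VSet V → Set
_⊆V_ {V} Ω Ω' = ∀ (v : V) → T (Ω v) → T (Ω' v)

IsClique : {V : Set} → Rel V → VSet V → Set
IsClique {V} H Ω = ∀ (u v : V) → T (Ω u) → T (Ω v) → u ≢ v → T (H u v)

IsMaximalClique : {V : Set} → Rel V → VSet V → Set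
IsMaximalClique H Ω =
  IsClique H Ω × (∀ Ω' → IsClique H Ω' → ¬ (Ω ⊆V Ω' × ¬ (Ω' ⊆V Ω)))

IsPMC : {V : Set} → Rel V → VSet V → Set
IsPMC {V} E Ω = Σ (Rel V) λ H → IsMinimalTriangulation E H × IsMaximalClique H Ω

IsFree : {V : Set} → Rel V → VSet V → Set
IsFree {V} E Ω = ∀ (v : V) → T (Ω v) → ∃[ u ] (Ω u ≡ false × T (E v u))

-- Reach E Ω u v : u and v lie in the same connected component of E ∖ Ω
-- (the subgraph induced by the vertices outside Ω)
data Reach {V : Set} (E : Rel V) (Ω : VSet V) : V → V → Set where
  here : ∀ v → Ω v ≡ false → Reach E Ω v v
  step : ∀ u v w → Reach E Ω u v → Ω w ≡ false → T (E v w) → Reach E Ω u w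

-- The graph M(G, V_k).  G has vertex set Fin n with adjacency adj.
-- V(M) = V(G) ⊎ { M_X | X ⊆ V_k, X non-empty }.

MVertex : (n : ℕ) → Subset n → Set
MVertex n Vk = Fin n ⊎ Σ (Subset n) (λ X → True (X ⊆? Vk) × True (nonempty? X))

MAdj : {n : ℕ} → (Fin n → Fin n → Bool) → (Vk : Subset n) → Rel (MVertex n Vk)
MAdj adj Vk (inj₁ u)       (inj₁ v)       = adj u v
MAdj adj Vk (inj₁ u)       (inj₂ (X , _)) = lookup X u
MAdj adj Vk (inj₂ (X , _)) (inj₁ u)       = lookup X u
MAdj adj Vk (inj₂ _)       (inj₂ _)       = false

IsVertexCover : {n : ℕ} → (Fin n → Fin n → Bool) → Subset n → Set
IsVertexCover {n} adj S = ∀ (u v : Fin n) → T (adj u v) → u ∈ S ⊎ v ∈ S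

IsPartition4 : {n : ℕ} → Subset n → Subset n → Subset n → Subset n → Subset n → Set
IsPartition4 S A P₁ P₂ P₃ =
  Nonempty A × Nonempty P₁ × Nonempty P₂ × Nonempty P₃ ×
  (A ∪ (P₁ ∪ (P₂ ∪ P₃)) ≡ S) ×
  Empty (A ∩ P₁) × Empty (A ∩ P₂) × Empty (A ∩ P₃) ×
  Empty (P₁ ∩ P₂) × Empty (P₁ ∩ P₃) × Empty (P₂ ∩ P₃)

-- V_k ∩ C, for C the component of M ∖ Ω containing w, equals the set P
CompTrace≡ : {n : ℕ} → (adj : Fin n → Fin n → Bool) → (Vk : Subset n) →
             VSet (MVertex n Vk) → MVertex n Vk → Subset n → Set
CompTrace≡ {n} adj Vk Ω w P =
  ∀ (x : Fin n) → ((x ∈ Vk × Reach (MAdj adj Vk) Ω w (inj₁ x)) ⇔ x ∈ P)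

CompTraceNonempty : {n : ℕ} → (adj : Fin n → Fin n → Bool) → (Vk : Subset n) →
                    VSet (MVertex n Vk) → MVertex n Vk → Set
CompTraceNonempty {n} adj Vk Ω w =
  ∃[ x ] (x ∈ Vk × Reach (MAdj adj Vk) Ω w (inj₁ x))

-- P(Ω) = {A, P₁, P₂, P₃}: V_k ∩ Ω = A, and the non-empty sets V_k ∩ C over the
-- components C of M ∖ Ω (each C being the component of some w ∉ Ω) are
-- exactly P₁, P₂, P₃.
PartitionIs : {n : ℕ} → (adj : Fin n → Fin n → Bool) → (Vk : Subset n) →
              VSet (MVertex n Vk) → Subset n → Subset n → Subset n → Subset n → Set
PartitionIs {n} adj Vk Ω A P₁ P₂ P₃ =
  (∀ (x : Fin n) → ((x ∈ Vk × T (Ω (inj₁ x))) ⇔ x ∈ A)) ×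
  (∀ w → Ω w ≡ false → CompTraceNonempty adj Vk Ω w →
     CompTrace≡ adj Vk Ω w P₁ ⊎ CompTrace≡ adj Vk Ω w P₂ ⊎ CompTrace≡ adj Vk Ω w P₃) ×
  (∃[ w ] (Ω w ≡ false × CompTrace≡ adj Vk Ω w P₁)) ×
  (∃[ w ] (Ω w ≡ false × CompTrace≡ adj Vk Ω w P₂)) ×
  (∃[ w ] (Ω w ≡ false × CompTrace≡ adj Vk Ω w P₃))

{-# OPTIONS --safe #-}
module Submission where

-- Suppose v ∈ Ω ∖ Ω'. Both cliques meet V_k exactly in A, so v ∉ V_k; hence every
-- neighbour of v lies in V_k, and as v ∉ Ω' the neighbours lie in A ∪ P_l for a single
-- part P_l. Now work in Ω, a maximal clique of a minimal triangulation H of M. The vertex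
-- w = M_X with X = P_j ∪ P_k, the union of the other two parts, has neighbours in two
-- different components of M ∖ Ω, so w ∈ Ω as well. Put v and the component C of M ∖ Ω
-- with trace P_l on one side, and w with the rest of M ∖ Ω on the other. No edge of M
-- joins the sides and Ω ∖ {v, w} is a clique of H, so deleting from H every edge between
-- the sides leaves a triangulation: a cycle meeting both sides passes twice through that
-- clique, at non-consecutive places. Minimality of H then forbids the edge vw, although
-- v and w both lie in the clique Ω.

open import Defs
open import Data.Nat using (ℕ; zero; suc; _+_; _*_; _∸_; _≤_; _<_; s≤s; z<s; NonZero; _%_; _/_)
open import Data.Nat.Properties
open import Data.Nat.DivMod
  using (_mod_; m%n<n; m<n⇒m%n≡m; m%n%n≡m%n; [m+n]%n≡m%n; %-distribˡ-+; m≡m%n+[m/n]*n; n%n≡0)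
open import Data.Fin using (Fin; zero; suc; toℕ; punchIn)
import Data.Fin.Properties as Fin
open import Data.Fin.Properties using (toℕ-injective; toℕ-fromℕ<; toℕ<n)
open import Data.Fin.Subset using (Subset; _∈_; _⊆_; _∪_; _∩_; Empty; Nonempty; ∣_∣)
open import Data.Fin.Subset.Properties using (_∈?_; x∈p∪q⁺; x∈p∪q⁻; x∈p∩q⁺)
open import Data.Bool using (Bool; true; false; T; _∧_; not)
import Data.Bool.Properties as Bool
open import Data.Bool.Properties using (T-≡; T-∧; T-not-≡; T-irrelevant)
open import Data.Vec using ([]; _∷_; lookup)
import Data.Vec.Properties as Vec
open import Data.Vec.Properties using ([]=⇒lookup; lookup⇒[]=)
import Data.Product.Properties as Product
import Data.Sum.Properties as Sum
open import Data.Product using (∃-syntax; _×_; _,_; proj₁; proj₂)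
open import Data.Sum using (_⊎_; inj₁; inj₂)
open import Data.Empty using (⊥; ⊥-elim)
open import Data.Unit using (tt)
open import Function.Base using (_∘_)
open import Function.Bundles using (module Equivalence)
open import Relation.Nullary using (¬_; yes; no; Dec)
open import Relation.Nullary.Decidable using (⌊_⌋; toWitness; fromWitness; _×-dec_; _⊎-dec_; T?)
open import Relation.Binary.Definitions using (DecidableEquality; tri<; tri≈; tri>)
open import Relation.Binary.PropositionalEquality

open Equivalence using (to; from)

-- Positions on a cycle of length N are natural numbers read modulo N, so that every arc
-- of the cycle becomes an interval of ℕ.
module CyclicPosition (N : ℕ) .{{_ : NonZero N}} where

  pos : ℕ → Fin N
  pos k = k mod N

  toℕ-pos : ∀ k → toℕ (pos k) ≡ k % N
  toℕ-pos k = toℕ-fromℕ< (m%n<n k N)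

  pos-toℕ : ∀ i → pos (toℕ i) ≡ i
  pos-toℕ i = toℕ-injective (trans (toℕ-pos (toℕ i)) (m<n⇒m%n≡m (toℕ<n i)))

  pos-+N : ∀ k → pos (k + N) ≡ pos k
  pos-+N k = toℕ-injective (trans (toℕ-pos (k + N)) (trans ([m+n]%n≡m%n k N) (sym (toℕ-pos k))))

  pos≡⇒%≡ : ∀ {k l} → pos k ≡ pos l → k % N ≡ l % N
  pos≡⇒%≡ {k} {l} eq = trans (sym (toℕ-pos k)) (trans (cong toℕ eq) (toℕ-pos l))

  suc-toℕ-pos : ∀ k → suc (toℕ (pos k)) % N ≡ suc k % N
  suc-toℕ-pos k = begin
    (1 + toℕ (pos k)) % N       ≡⟨ cong (λ r → (1 + r) % N) (toℕ-pos k) ⟩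
    (1 + k % N) % N             ≡⟨ %-distribˡ-+ 1 (k % N) N ⟩
    (1 % N + k % N % N) % N     ≡⟨ cong (λ r → (1 % N + r) % N) (m%n%n≡m%n k N) ⟩
    (1 % N + k % N) % N         ≡⟨ %-distribˡ-+ 1 k N ⟨
    (1 + k) % N                 ∎
    where open ≡-Reasoning

  Consec⇒suc% : ∀ {a b} → Consec N a b → toℕ b ≡ suc (toℕ a) % N
  Consec⇒suc% {b = b} (inj₁ 1+a≡b) =
    sym (trans (m<n⇒m%n≡m (subst (_< N) (sym 1+a≡b) (toℕ<n b))) 1+a≡b)
  Consec⇒suc% (inj₂ (1+a≡N , b≡0)) = trans b≡0 (sym (trans (cong (_% N) 1+a≡N) (n%n≡0 N)))

  suc%⇒Consec : ∀ {a b} → toℕ b ≡ suc (toℕ a) % N → Consec N a b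
  suc%⇒Consec {a} eq with suc (toℕ a) <? N
  ... | yes 1+a<N = inj₁ (sym (trans eq (m<n⇒m%n≡m 1+a<N)))
  ... | no 1+a≮N = inj₂ (1+a≡N , trans eq (trans (cong (_% N) 1+a≡N) (n%n≡0 N)))
    where 1+a≡N = ≤-antisym (toℕ<n a) (≮⇒≥ 1+a≮N)

  consec-pos : ∀ k → Consec N (pos k) (pos (suc k))
  consec-pos k = suc%⇒Consec (trans (toℕ-pos (suc k)) (sym (suc-toℕ-pos k)))

  Consec-pos⇒ : ∀ {k l} → Consec N (pos k) (pos l) → l % N ≡ suc k % N
  Consec-pos⇒ {k} {l} c = trans (sym (toℕ-pos l)) (trans (Consec⇒suc% c) (suc-toℕ-pos k))

  0<d<N⇒d≢q*N : ∀ {d} q → 0 < d → d < N → d ≢ q * N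
  0<d<N⇒d≢q*N zero    0<0 _      refl = <-irrefl refl 0<0
  0<d<N⇒d≢q*N (suc q) _   N+qN<N refl = <⇒≱ N+qN<N (m≤m+n N (q * N))

  [d+x]%N≢x%N : ∀ d x → 0 < d → d < N → (d + x) % N ≢ x % N
  [d+x]%N≢x%N d x 0<d d<N eq = 0<d<N⇒d≢q*N ((d + r) / N) 0<d d<N d≡qN
    where
    open ≡-Reasoning
    r = x % N
    [d+r]%N≡r : (d + r) % N ≡ r
    [d+r]%N≡r = begin
      (d + r) % N           ≡⟨ cong (λ e → (e + r) % N) (m<n⇒m%n≡m d<N) ⟨
      (d % N + r) % N       ≡⟨ %-distribˡ-+ d x N ⟨
      (d + x) % N           ≡⟨ eq ⟩
      r                     ∎
    d≡qN : d ≡ (d + r) / N * N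
    d≡qN = +-cancelˡ-≡ r _ _ (begin
      r + d                           ≡⟨ +-comm r d ⟩
      d + r                           ≡⟨ m≡m%n+[m/n]*n (d + r) N ⟩
      (d + r) % N + (d + r) / N * N   ≡⟨ cong (_+ (d + r) / N * N) [d+r]%N≡r ⟩
      r + (d + r) / N * N             ∎)

  Apart : Fin N → Fin N → Set
  Apart a b = a ≢ b × ¬ Consec N a b × ¬ Consec N b a

  pos-apart : ∀ {x y} → 2 + x ≤ y → 2 + y ≤ x + N → Apart (pos x) (pos y)
  pos-apart {x} {y} 2+x≤y 2+y≤x+N =
    subst (Apart (pos x) ∘ pos) (m∸n+n≡m x≤y) (apart (y ∸ x) (m+n≤o⇒m≤o∸n 2 2+x≤y) 2+d≤N)
    where
    x≤y = m+n≤o⇒n≤o 2 2+x≤y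
    2+d≤N : 2 + (y ∸ x) ≤ N
    2+d≤N = +-cancelʳ-≤ x _ _ (subst₂ _≤_ (cong (2 +_) (sym (m∸n+n≡m x≤y))) (+-comm x N) 2+y≤x+N)
    apart : ∀ d → 2 ≤ d → 2 + d ≤ N → Apart (pos x) (pos (d + x))
    apart d@(suc (suc e)) (s≤s (s≤s _)) 2+d≤N =
        (λ eq → [d+x]%N≢x%N d x z<s d<N (sym (pos≡⇒%≡ eq)))
      , (λ c → [d+x]%N≢x%N (suc e) (suc x) z<s (<-trans (n<1+n _) d<N)
                 (trans (cong (_% N) (+-suc (suc e) x)) (Consec-pos⇒ c)))
      , (λ c → [d+x]%N≢x%N (suc d) x z<s 2+d≤N (sym (Consec-pos⇒ c)))
      where
      d<N : d < N
      d<N = <-trans (n<1+n _) 2+d≤N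

data Side : Set where
  left middle right : Side

Opposite : Side → Side → Bool
Opposite left  right = true
Opposite right left  = true
Opposite _     _     = false

Opposite-sym : ∀ s t → Opposite s t ≡ Opposite t s
Opposite-sym left   left   = refl
Opposite-sym left   middle = refl
Opposite-sym left   right  = refl
Opposite-sym middle left   = refl
Opposite-sym middle middle = refl
Opposite-sym middle right  = refl
Opposite-sym right  left   = refl
Opposite-sym right  middle = refl
Opposite-sym right  right  = refl

Opposite⇒≢ : ∀ {s t} → Opposite s t ≡ true → s ≢ t
Opposite⇒≢ {left}   () refl
Opposite⇒≢ {middle} () refl
Opposite⇒≢ {right}  () refl

Opposite⇒≢middle : ∀ {s t} → Opposite s t ≡ true → s ≢ middle
Opposite⇒≢middle () refl

¬Opposite⇒middle-or-same : ∀ {s t u} → Opposite s t ≡ true → Opposite u t ≡ false → u ≡ middle ⊎ u ≡ t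
¬Opposite⇒middle-or-same {left}  {right} {left}   _ ()
¬Opposite⇒middle-or-same {left}  {right} {middle} _ _ = inj₁ refl
¬Opposite⇒middle-or-same {left}  {right} {right}  _ _ = inj₂ refl
¬Opposite⇒middle-or-same {right} {left}  {left}   _ _ = inj₂ refl
¬Opposite⇒middle-or-same {right} {left}  {middle} _ _ = inj₁ refl
¬Opposite⇒middle-or-same {right} {left}  {right}  _ ()

module _ {V : Set} (σ : V → Side) where

  NoOppositeEdge : Rel V → Set
  NoOppositeEdge R = ∀ a b → T (R a b) → Opposite (σ a) (σ b) ≡ false

  MiddleClique : Rel V → Set
  MiddleClique R = ∀ a b → σ a ≡ middle → σ b ≡ middle → a ≢ b → T (R a b)

  removeOpposite : Rel V → Rel V
  removeOpposite H x y = H x y ∧ not (Opposite (σ x) (σ y))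

  module _ {R : Rel V} (noOpp : NoOppositeEdge R) where

    module _ (g : ℕ → V) (edge : ∀ k → T (R (g k) (g (suc k))))
             {s t : Side} (s⇎t : Opposite s t ≡ true) where

      private
        walk : ∀ a d → σ (g a) ≡ s → σ (g (d + a)) ≡ t → ∃[ p ] a < p × p < d + a × σ (g p) ≡ middle
        walk a zero    ga≡s ga≡t = ⊥-elim (Opposite⇒≢ s⇎t (trans (sym ga≡s) ga≡t))
        walk a (suc d) ga≡s end≡t
          with ¬Opposite⇒middle-or-same s⇎t
                 (subst (λ t → Opposite _ t ≡ false) end≡t (noOpp _ _ (edge (d + a))))
        ... | inj₂ prev≡t =
          let p , a<p , p<d+a , gp≡middle = walk a d ga≡s prev≡t
          in p , a<p , m<n⇒m<1+n p<d+a , gp≡middle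
        ... | inj₁ prev≡middle = d + a , a<d+a d prev≡middle , n<1+n (d + a) , prev≡middle
          where
          a<d+a : ∀ d → σ (g (d + a)) ≡ middle → a < d + a
          a<d+a zero    ga≡middle = ⊥-elim (Opposite⇒≢middle s⇎t (trans (sym ga≡s) ga≡middle))
          a<d+a (suc d) _         = m<n+m a z<s

      walk-meets-middle : ∀ {a b} → a ≤ b → σ (g a) ≡ s → σ (g b) ≡ t →
                          ∃[ p ] a < p × p < b × σ (g p) ≡ middle
      walk-meets-middle {a} {b} a≤b ga≡s gb≡t =
        subst (λ b → ∃[ p ] a < p × p < b × σ (g p) ≡ middle) (m∸n+n≡m a≤b)
              (walk a (b ∸ a) ga≡s (trans (cong (σ ∘ g) (m∸n+n≡m a≤b)) gb≡t))

    module _ (clique : MiddleClique R) {N : ℕ} .{{_ : NonZero N}} {f : Fin N → V} (cyc : IsCycle R N f) where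
      open CyclicPosition N

      apart-middle-chord : ∀ {p q} → Apart p q → σ (f p) ≡ middle → σ (f q) ≡ middle → HasChord R N f
      apart-middle-chord (p≢q , ¬p→q , ¬q→p) fp fq =
        _ , _ , p≢q , ¬p→q , ¬q→p , clique _ _ fp fq (p≢q ∘ proj₁ cyc)

      private
        g : ℕ → V
        g k = f (pos k)

        g-edge : ∀ k → T (R (g k) (g (suc k)))
        g-edge k = proj₂ cyc _ _ (consec-pos k)

        σg-toℕ : ∀ i → σ (g (toℕ i)) ≡ σ (f i)
        σg-toℕ i = cong (σ ∘ f) (pos-toℕ i)

        σg-toℕ+N : ∀ i → σ (g (toℕ i + N)) ≡ σ (f i)
        σg-toℕ+N i = cong (σ ∘ f) (trans (pos-+N (toℕ i)) (pos-toℕ i))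

        toℕ≤toℕ+N : ∀ (i j : Fin N) → toℕ j ≤ toℕ i + N
        toℕ≤toℕ+N i j = ≤-trans (<⇒≤ (toℕ<n j)) (m≤n+m N (toℕ i))

        -- Both arcs between i and j, from i to j and from j on to i + N, lead from one
        -- side to the other, so each passes through the middle; the two middle vertices
        -- found are at cyclic distance at least 2 from each other.
        ordered-chord : ∀ i j → toℕ i < toℕ j → Opposite (σ (f i)) (σ (f j)) ≡ true → HasChord R N f
        ordered-chord i j i<j i⇎j
          with walk-meets-middle g g-edge i⇎j (<⇒≤ i<j) (σg-toℕ i) (σg-toℕ j)
             | walk-meets-middle g g-edge (trans (Opposite-sym _ _) i⇎j)
                 (toℕ≤toℕ+N i j) (σg-toℕ j) (σg-toℕ+N i)
        ... | p , i<p , p<j , gp | q , j<q , q<i+N , gq =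
          apart-middle-chord (pos-apart (≤-trans (s≤s p<j) j<q) (≤-trans (s≤s q<i+N) (+-monoˡ-≤ N i<p))) gp gq

      opposite-cycle-has-chord : ∀ i j → Opposite (σ (f i)) (σ (f j)) ≡ true → HasChord R N f
      opposite-cycle-has-chord i j i⇎j with <-cmp (toℕ i) (toℕ j)
      ... | tri< i<j _ _ = ordered-chord i j i<j i⇎j
      ... | tri≈ _ i≡j _ = ⊥-elim (Opposite⇒≢ i⇎j (cong (σ ∘ f) (toℕ-injective i≡j)))
      ... | tri> _ _ j<i = ordered-chord j i j<i (trans (Opposite-sym _ _) i⇎j)

  module _ {H : Rel V} where

    removeOpposite-⊆ : removeOpposite H ⊆E H
    removeOpposite-⊆ _ _ h = proj₁ (to T-∧ h)

    removeOpposite-noOpposite : NoOppositeEdge (removeOpposite H)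
    removeOpposite-noOpposite _ _ h = to T-not-≡ (proj₂ (to T-∧ h))

    removeOpposite-keeps : ∀ {x y} → T (H x y) → Opposite (σ x) (σ y) ≡ false → T (removeOpposite H x y)
    removeOpposite-keeps h x≠y = from T-∧ (h , from T-not-≡ x≠y)

    middleClique-removeOpposite : MiddleClique H → MiddleClique (removeOpposite H)
    middleClique-removeOpposite clique a b a-mid b-mid a≢b =
      removeOpposite-keeps (clique a b a-mid b-mid a≢b) (cong₂ Opposite a-mid b-mid)

    chordal-removeOpposite : Chordal H → MiddleClique H → Chordal (removeOpposite H)
    chordal-removeOpposite chordal clique (suc m) 4≤m f cyc
      with chordal (suc m) 4≤m f (proj₁ cyc , λ i j c → removeOpposite-⊆ _ _ (proj₂ cyc i j c))
    ... | i , j , i≢j , ¬i→j , ¬j→i , h with Opposite (σ (f i)) (σ (f j)) in fi⇎fj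
    ...   | false = i , j , i≢j , ¬i→j , ¬j→i , removeOpposite-keeps h fi⇎fj
    ...   | true  =
      opposite-cycle-has-chord removeOpposite-noOpposite (middleClique-removeOpposite clique) cyc i j fi⇎fj

  minimalTriangulation-noOpposite : ∀ {E H} → IsMinimalTriangulation E H → MiddleClique H →
                                    NoOppositeEdge E → NoOppositeEdge H
  minimalTriangulation-noOpposite {E} {H} (((H-sym , H-loop) , E⊆H , chordal) , minimal) clique noOppE x y h
    with Opposite (σ x) (σ y) in x⇎y
  ... | false = refl
  ... | true  = ⊥-elim (minimal (removeOpposite H) triangulation (removeOpposite-⊆ {H = H} , H⊈H'))
    where
    triangulation : IsTriangulation E (removeOpposite H)
    triangulation = ( (λ u v → cong₂ _∧_ (H-sym u v) (cong not (Opposite-sym (σ u) (σ v))))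
                    , (λ v → cong (_∧ _) (H-loop v)) )
                  , (λ u v e → removeOpposite-keeps {H = H} (E⊆H u v e) (noOppE u v e))
                  , chordal-removeOpposite chordal clique
    H⊈H' : ¬ (H ⊆E removeOpposite H)
    H⊈H' H⊆H' with trans (sym x⇎y) (removeOpposite-noOpposite {H = H} x y (H⊆H' x y h))
    ... | ()

IsComponentUnion : {V : Set} → Rel V → VSet V → VSet V → Set
IsComponentUnion {V} E Ω C =
  (∀ x → T (C x) → Ω x ≡ false) × (∀ x y → T (C x) → T (E x y) → Ω y ≡ false → T (C y))

module Separation {V : Set} (_≟_ : DecidableEquality V) (v w : V) (Ω C : VSet V) where

  side : V → Side
  side x with x ≟ v | C x | Ω x | x ≟ w
  ... | yes _ | _     | _     | _     = left
  ... | no _  | true  | _     | _     = left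
  ... | no _  | false | false | _     = right
  ... | no _  | false | true  | yes _ = right
  ... | no _  | false | true  | no _  = middle

  side-left : ∀ x → side x ≡ left → x ≡ v ⊎ T (C x)
  side-left x with x ≟ v | C x | Ω x | x ≟ w
  ... | yes x≡v | _     | _     | _     = λ _ → inj₁ x≡v
  ... | no _    | true  | _     | _     = λ _ → inj₂ tt
  ... | no _    | false | false | _     = λ ()
  ... | no _    | false | true  | yes _ = λ ()
  ... | no _    | false | true  | no _  = λ ()

  side-right : ∀ x → side x ≡ right → ¬ T (C x) × (Ω x ≡ false ⊎ x ≡ w)
  side-right x with x ≟ v | C x | Ω x | x ≟ w
  ... | yes _ | _     | _     | _       = λ ()
  ... | no _  | true  | _     | _       = λ ()
  ... | no _  | false | false | _       = λ _ → (λ ()) , inj₁ refl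
  ... | no _  | false | true  | yes x≡w = λ _ → (λ ()) , inj₂ x≡w
  ... | no _  | false | true  | no _    = λ ()

  side-middle : ∀ x → side x ≡ middle → T (Ω x)
  side-middle x with x ≟ v | C x | Ω x | x ≟ w
  ... | yes _ | _     | _     | _     = λ ()
  ... | no _  | true  | _     | _     = λ ()
  ... | no _  | false | false | _     = λ ()
  ... | no _  | false | true  | yes _ = λ ()
  ... | no _  | false | true  | no _  = λ _ → tt

  side-v : side v ≡ left
  side-v with v ≟ v
  ... | yes _ = refl
  ... | no v≢v = ⊥-elim (v≢v refl)

  side-w : v ≢ w → ¬ T (C w) → T (Ω w) → side w ≡ right
  side-w v≢w w∉C w∈Ω with w ≟ v | C w | Ω w | w ≟ w
  ... | yes w≡v | _     | _     | _       = ⊥-elim (v≢w (sym w≡v))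
  ... | no _    | true  | _     | _       = ⊥-elim (w∉C tt)
  ... | no _    | false | false | _       = refl
  ... | no _    | false | true  | yes _   = refl
  ... | no _    | false | true  | no w≢w  = ⊥-elim (w≢w refl)

module _ {V : Set} (_≟_ : DecidableEquality V) {E H : Rel V} (E-sym : ∀ x y → E x y ≡ E y x)
         (minimal : IsMinimalTriangulation E H) {Ω : VSet V} (clique : IsClique H Ω) where

  -- Put v and C on the left and w with the rest of the outside of Ω on the right. Then
  -- E has no left–right edge and the middle Ω ∖ {v, w} is a clique of H, so by
  -- minimality H has no left–right edge either; yet vw is one.
  separated-clique-pair-⊥ : ∀ {v w C} → T (Ω v) → T (Ω w) → v ≢ w → E v w ≡ false →
                            IsComponentUnion E Ω C →
                            (∀ y → T (E v y) → Ω y ≡ false → T (C y)) →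
                            (∀ y → T (E w y) → ¬ T (C y)) → ⊥
  separated-clique-pair-⊥ {v} {w} {C} v∈Ω w∈Ω v≢w v≁w (C∩Ω≡∅ , C-closed) v-nbrs w-nbrs =
    true≢false (begin
      Opposite left right         ≡⟨ cong₂ Opposite side-v (side-w v≢w w∉C w∈Ω) ⟨
      Opposite (side v) (side w)  ≡⟨ noOppositeH v w (clique v w v∈Ω w∈Ω v≢w) ⟩
      false                       ∎)
    where
    open ≡-Reasoning
    open Separation _≟_ v w Ω C

    true≢false : true ≢ false
    true≢false ()

    w∉C : ¬ T (C w)
    w∉C w∈C = subst T (C∩Ω≡∅ w w∈C) w∈Ω

    middle-clique : MiddleClique side H
    middle-clique a b a-mid b-mid = clique a b (side-middle a a-mid) (side-middle b b-mid)

    ¬left-right-edge : ∀ x y → side x ≡ left → side y ≡ right → T (E x y) → ⊥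
    ¬left-right-edge x y x-left y-right x~y
      with side-left x x-left | side-right y y-right
    ... | inj₁ refl | y∉C , inj₁ y∉Ω = y∉C (v-nbrs y x~y y∉Ω)
    ... | inj₁ refl | _   , inj₂ refl = subst T v≁w x~y
    ... | inj₂ x∈C  | y∉C , inj₁ y∉Ω = y∉C (C-closed x y x∈C x~y y∉Ω)
    ... | inj₂ x∈C  | _   , inj₂ refl = w-nbrs x (subst T (E-sym x w) x~y) x∈C

    noOppositeE : NoOppositeEdge side E
    noOppositeE x y x~y with side x in x-side | side y in y-side
    ... | left   | right  = ⊥-elim (¬left-right-edge x y x-side y-side x~y)
    ... | right  | left   = ⊥-elim (¬left-right-edge y x y-side x-side (subst T (E-sym x y) x~y))
    ... | left   | left   = refl
    ... | left   | middle = refl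
    ... | middle | _      = refl
    ... | right  | middle = refl
    ... | right  | right  = refl

    noOppositeH : NoOppositeEdge side H
    noOppositeH = minimalTriangulation-noOpposite side minimal middle-clique noOppositeE

⊆V-antisym : {V : Set} {Ω Ω' : VSet V} → Ω ⊆V Ω' → Ω' ⊆V Ω → ∀ v → Ω v ≡ Ω' v
⊆V-antisym {Ω = Ω} {Ω'} Ω⊆Ω' Ω'⊆Ω v with Ω v in Ωv | Ω' v in Ω'v
... | true  | true  = refl
... | false | false = refl
... | true  | false = ⊥-elim (subst T Ω'v (Ω⊆Ω' v (subst T (sym Ωv) tt)))
... | false | true  = ⊥-elim (subst T Ωv (Ω'⊆Ω v (subst T (sym Ω'v) tt)))

joins-two-components⇒∈ : {V : Set} {E : Rel V} {Ω : VSet V} {w a b : V} →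
                          T (E w a) → T (E w b) → Ω a ≡ false → Ω b ≡ false →
                          (∀ u → Ω u ≡ false → Reach E Ω u a → Reach E Ω u b → ⊥) → T (Ω w)
joins-two-components⇒∈ {Ω = Ω} {w} {a} {b} w~a w~b a∉Ω b∉Ω separated with Ω w in w∈?Ω
... | true  = tt
... | false = separated w w∈?Ω (step w w a (here w w∈?Ω) a∉Ω w~a) (step w w b (here w w∈?Ω) b∉Ω w~b)

T-lookup⇒∈ : ∀ {n} {X : Subset n} {z} → T (lookup X z) → z ∈ X
T-lookup⇒∈ {X = X} {z} t = lookup⇒[]= z X (to T-≡ t)

∈⇒T-lookup : ∀ {n} {X : Subset n} {z} → z ∈ X → T (lookup X z)
∈⇒T-lookup z∈X = from T-≡ ([]=⇒lookup z∈X)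

module _ {n : ℕ} {Vk : Subset n} where

  private
    V = MVertex n Vk

  _≟M_ : DecidableEquality V
  _≟M_ = Sum.≡-dec Fin._≟_ (Product.≡-dec (Vec.≡-dec Bool._≟_) λ _ _ →
           yes (cong₂ _,_ (T-irrelevant _ _) (T-irrelevant _ _)))

  InVk : V → Set
  InVk x = ∃[ z ] x ≡ inj₁ z × z ∈ Vk

  InVk? : ∀ x → Dec (InVk x)
  InVk? (inj₁ z) with z ∈? Vk
  ... | yes z∈Vk = yes (z , refl , z∈Vk)
  ... | no  z∉Vk = no λ { (_ , refl , z∈Vk) → z∉Vk z∈Vk }
  InVk? (inj₂ _) = no λ { (_ , () , _) }

  InVk-inj₁ : ∀ {z} → InVk (inj₁ z) → z ∈ Vk
  InVk-inj₁ (_ , refl , z∈Vk) = z∈Vk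

  marker : (X : Subset n) → X ⊆ Vk → Nonempty X → V
  marker X X⊆Vk X≢∅ = inj₂ (X , fromWitness (λ {z} → X⊆Vk {z}) , fromWitness X≢∅)

module _ {n : ℕ} {adj : Fin n → Fin n → Bool} {Vk : Subset n} where

  private
    V = MVertex n Vk
    M = MAdj adj Vk

  MAdj-sym : (∀ u v → adj u v ≡ adj v u) → ∀ x y → M x y ≡ M y x
  MAdj-sym adj-sym (inj₁ u) (inj₁ v) = adj-sym u v
  MAdj-sym _       (inj₁ _) (inj₂ _) = refl
  MAdj-sym _       (inj₂ _) (inj₁ _) = refl
  MAdj-sym _       (inj₂ _) (inj₂ _) = refl

  MAdj-cover : IsVertexCover adj Vk → ∀ x y → T (M x y) → InVk x ⊎ InVk y
  MAdj-cover vc (inj₁ u) (inj₁ v) u~v with vc u v u~v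
  ... | inj₁ u∈Vk = inj₁ (u , refl , u∈Vk)
  ... | inj₂ v∈Vk = inj₂ (v , refl , v∈Vk)
  MAdj-cover _ (inj₁ u) (inj₂ (X , X⊆Vk , _)) u∈X = inj₁ (u , refl , toWitness X⊆Vk (T-lookup⇒∈ u∈X))
  MAdj-cover _ (inj₂ (X , X⊆Vk , _)) (inj₁ v) v∈X = inj₂ (v , refl , toWitness X⊆Vk (T-lookup⇒∈ v∈X))

  adjacent-to-marker⇒InVk : IsVertexCover adj Vk → ∀ x m → T (M x (inj₂ m)) → InVk x
  adjacent-to-marker⇒InVk vc x m x~m with MAdj-cover vc x (inj₂ m) x~m
  ... | inj₁ x∈Vk = x∈Vk
  ... | inj₂ (_ , () , _)

parts : ∀ {n} → Subset n → Subset n → Subset n → Fin 3 → Subset n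
parts P₁ P₂ P₃ = lookup (P₁ ∷ P₂ ∷ P₃ ∷ [])

record IsIndexedPartition {n : ℕ} (Vk A : Subset n) (P : Fin 3 → Subset n) : Set where
  field
    nonempty   : ∀ i → Nonempty (P i)
    ⊆Vk        : ∀ i → P i ⊆ Vk
    disjoint-A : ∀ i {z} → z ∈ A → z ∈ P i → ⊥
    disjoint   : ∀ {i j z} → i ≢ j → z ∈ P i → z ∈ P j → ⊥

isPartition4⇒indexed : ∀ {n} {Vk A P₁ P₂ P₃ : Subset n} →
                       IsPartition4 Vk A P₁ P₂ P₃ → IsIndexedPartition Vk A (parts P₁ P₂ P₃)
isPartition4⇒indexed {P₁ = P₁} {P₂} {P₃}
                     (_ , ne₁ , ne₂ , ne₃ , ∪≡Vk , A₁ , A₂ , A₃ , d₁₂ , d₁₃ , d₂₃) = record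
  { nonempty   = λ { zero → ne₁ ; (suc zero) → ne₂ ; (suc (suc zero)) → ne₃ }
  ; ⊆Vk        = λ i → subst (_ ∈_) ∪≡Vk ∘ x∈p∪q⁺ ∘ inj₂ ∘ ∈P₁₂₃ i
  ; disjoint-A = λ { zero → apart A₁ ; (suc zero) → apart A₂ ; (suc (suc zero)) → apart A₃ }
  ; disjoint   = disjoint
  }
  where
  apart : ∀ {p q : Subset _} → Empty (p ∩ q) → ∀ {z} → z ∈ p → z ∈ q → ⊥
  apart p∩q≡∅ z∈p z∈q = p∩q≡∅ (_ , x∈p∩q⁺ (z∈p , z∈q))

  ∈P₁₂₃ : ∀ i {z} → z ∈ parts P₁ P₂ P₃ i → z ∈ P₁ ∪ (P₂ ∪ P₃)
  ∈P₁₂₃ zero             = x∈p∪q⁺ ∘ inj₁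
  ∈P₁₂₃ (suc zero)       = x∈p∪q⁺ ∘ inj₂ ∘ x∈p∪q⁺ ∘ inj₁
  ∈P₁₂₃ (suc (suc zero)) = x∈p∪q⁺ ∘ inj₂ ∘ x∈p∪q⁺ ∘ inj₂

  disjoint : ∀ {i j z} → i ≢ j → z ∈ parts P₁ P₂ P₃ i → z ∈ parts P₁ P₂ P₃ j → ⊥
  disjoint {zero}           {zero}           i≢i = ⊥-elim (i≢i refl)
  disjoint {suc zero}       {suc zero}       i≢i = ⊥-elim (i≢i refl)
  disjoint {suc (suc zero)} {suc (suc zero)} i≢i = ⊥-elim (i≢i refl)
  disjoint {zero}           {suc zero}       _ = apart d₁₂
  disjoint {zero}           {suc (suc zero)} _ = apart d₁₃
  disjoint {suc zero}       {suc (suc zero)} _ = apart d₂₃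
  disjoint {suc zero}       {zero}           _ = λ z∈P₂ z∈P₁ → apart d₁₂ z∈P₁ z∈P₂
  disjoint {suc (suc zero)} {zero}           _ = λ z∈P₃ z∈P₁ → apart d₁₃ z∈P₁ z∈P₃
  disjoint {suc (suc zero)} {suc zero}       _ = λ z∈P₃ z∈P₂ → apart d₂₃ z∈P₂ z∈P₃

module _ {n : ℕ} {adj : Fin n → Fin n → Bool} {Vk : Subset n} {Ω : VSet (MVertex n Vk)}
         {A P₁ P₂ P₃ : Subset n} (pt : PartitionIs adj Vk Ω A P₁ P₂ P₃) where

  PartitionIs-trace : ∀ w → Ω w ≡ false → CompTraceNonempty adj Vk Ω w →
                      ∃[ i ] CompTrace≡ adj Vk Ω w (parts P₁ P₂ P₃ i)
  PartitionIs-trace w w∉Ω C∩Vk≢∅ with proj₁ (proj₂ pt) w w∉Ω C∩Vk≢∅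
  ... | inj₁ t        = zero , t
  ... | inj₂ (inj₁ t) = suc zero , t
  ... | inj₂ (inj₂ t) = suc (suc zero) , t

  PartitionIs-realised : ∀ i → ∃[ w ] Ω w ≡ false × CompTrace≡ adj Vk Ω w (parts P₁ P₂ P₃ i)
  PartitionIs-realised zero             = proj₁ (proj₂ (proj₂ pt))
  PartitionIs-realised (suc zero)       = proj₁ (proj₂ (proj₂ (proj₂ pt)))
  PartitionIs-realised (suc (suc zero)) = proj₂ (proj₂ (proj₂ (proj₂ pt)))

  PartitionIs-A⊆Ω : ∀ {z} → z ∈ A → T (Ω (inj₁ z))
  PartitionIs-A⊆Ω z∈A = proj₂ (from (proj₁ pt _) z∈A)

  PartitionIs-Vk∩Ω⊆A : ∀ {z} → z ∈ Vk → T (Ω (inj₁ z)) → z ∈ A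
  PartitionIs-Vk∩Ω⊆A z∈Vk z∈Ω = to (proj₁ pt _) (z∈Vk , z∈Ω)

module _ {n : ℕ} {adj : Fin n → Fin n → Bool} (adj-sym : ∀ u v → adj u v ≡ adj v u)
         {Vk : Subset n} (vc : IsVertexCover adj Vk)
         {A P₁ P₂ P₃ : Subset n} (partition : IsPartition4 Vk A P₁ P₂ P₃) where

  private
    V = MVertex n Vk
    M = MAdj adj Vk
    P = parts P₁ P₂ P₃
    open IsIndexedPartition (isPartition4⇒indexed partition)

  NeighboursIn : V → Subset n → Set
  NeighboursIn v Q = ∀ z → T (M v (inj₁ z)) → z ∈ A ⊎ z ∈ Q

  -- punchIn l enumerates the two indices other than l.
  otherParts : Fin 3 → Subset n
  otherParts l = P (punchIn l zero) ∪ P (punchIn l (suc zero))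

  otherParts-part : ∀ l {z} → z ∈ otherParts l → ∃[ m ] z ∈ P (punchIn l m)
  otherParts-part l z∈ with x∈p∪q⁻ (P (punchIn l zero)) _ z∈
  ... | inj₁ z∈Pj = zero , z∈Pj
  ... | inj₂ z∈Pk = suc zero , z∈Pk

  otherParts-⊆Vk : ∀ l → otherParts l ⊆ Vk
  otherParts-⊆Vk l z∈ = let m , z∈Pm = otherParts-part l z∈ in ⊆Vk (punchIn l m) z∈Pm

  otherParts-∉part : ∀ l {z} → z ∈ otherParts l → z ∈ P l → ⊥
  otherParts-∉part l z∈ = let m , z∈Pm = otherParts-part l z∈ in disjoint (Fin.punchInᵢ≢i l m) z∈Pm

  representative : ∀ l m → ∃[ z ] z ∈ otherParts l × z ∈ P (punchIn l m)
  representative l zero       = let z , z∈ = nonempty (punchIn l zero) in z , x∈p∪q⁺ (inj₁ z∈) , z∈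
  representative l (suc zero) = let z , z∈ = nonempty (punchIn l (suc zero)) in z , x∈p∪q⁺ (inj₂ z∈) , z∈

  otherMarker : Fin 3 → V
  otherMarker l = marker (otherParts l) (otherParts-⊆Vk l) (let z , z∈ , _ = representative l zero in z , z∈)

  neighbour-∈Vk : ∀ {v} → ¬ InVk v → ∀ z → T (M v (inj₁ z)) → z ∈ Vk
  neighbour-∈Vk {v} v∉Vk z v~z with MAdj-cover vc v (inj₁ z) v~z
  ... | inj₁ v∈Vk = ⊥-elim (v∉Vk v∈Vk)
  ... | inj₂ z∈Vk = InVk-inj₁ z∈Vk

  module _ {Ω : VSet V} (pt : PartitionIs adj Vk Ω A P₁ P₂ P₃) where

    part-∉Ω : ∀ i {z} → z ∈ P i → Ω (inj₁ z) ≡ false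
    part-∉Ω i {z} z∈Pi with Ω (inj₁ z) in z∈?Ω
    ... | true  = ⊥-elim (disjoint-A i (PartitionIs-Vk∩Ω⊆A pt (⊆Vk i z∈Pi) (subst T (sym z∈?Ω) tt)) z∈Pi)
    ... | false = refl

    component-trace : ∀ {u z} i → Ω u ≡ false → Reach M Ω u (inj₁ z) → z ∈ P i →
                      CompTrace≡ adj Vk Ω u (P i)
    component-trace {u} {z} i u∉Ω u⇝z z∈Pi with PartitionIs-trace pt u u∉Ω (z , ⊆Vk i z∈Pi , u⇝z)
    ... | m , trace with m Fin.≟ i
    ...   | yes refl = trace
    ...   | no  m≢i  = ⊥-elim (disjoint m≢i (to (trace z) (⊆Vk i z∈Pi , u⇝z)) z∈Pi)

    parts-in-distinct-components : ∀ {i j a b u} → i ≢ j → a ∈ P i → b ∈ P j → Ω u ≡ false →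
                                   Reach M Ω u (inj₁ a) → Reach M Ω u (inj₁ b) → ⊥
    parts-in-distinct-components {i} {j} {a} {b} i≢j a∈Pi b∈Pj u∉Ω u⇝a u⇝b =
      disjoint i≢j (to (component-trace i u∉Ω u⇝a a∈Pi b) (⊆Vk j b∈Pj , u⇝b)) b∈Pj

    otherMarker-∈Ω : ∀ l → T (Ω (otherMarker l))
    otherMarker-∈Ω l with representative l zero | representative l (suc zero)
    ... | _ , a∈X , a∈Pj | _ , b∈X , b∈Pk =
      joins-two-components⇒∈ (∈⇒T-lookup a∈X) (∈⇒T-lookup b∈X)
        (part-∉Ω (punchIn l zero) a∈Pj) (part-∉Ω (punchIn l (suc zero)) b∈Pk)
        (λ _ → parts-in-distinct-components ((λ ()) ∘ Fin.punchIn-injective l zero (suc zero)) a∈Pj b∈Pk)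

    root : Fin 3 → V
    root l = proj₁ (PartitionIs-realised pt l)

    root-trace : ∀ l → CompTrace≡ adj Vk Ω (root l) (P l)
    root-trace l = proj₂ (proj₂ (PartitionIs-realised pt l))

    Touches : Fin 3 → V → Set
    Touches l x = ∃[ z ] z ∈ P l × (x ≡ inj₁ z ⊎ T (M x (inj₁ z)))

    -- The component of M ∖ Ω with trace P l, in decidable form: each of its vertices lies
    -- in P l or is adjacent to it.
    component : Fin 3 → VSet V
    component l x =
      ⌊ (Ω x Bool.≟ false) ×-dec
        Fin.any? (λ z → (z ∈? P l) ×-dec ((x ≟M inj₁ z) ⊎-dec T? (M x (inj₁ z)))) ⌋

    component-intro : ∀ l {x} → Ω x ≡ false → Touches l x → T (component l x)
    component-intro l x∉Ω touches = fromWitness (x∉Ω , touches)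

    component-reached : ∀ l {x} → T (component l x) → Reach M Ω (root l) x
    component-reached l {x} x∈C with toWitness x∈C
    ... | _   , z , z∈Pl , inj₁ refl = proj₂ (from (root-trace l z) z∈Pl)
    ... | x∉Ω , z , z∈Pl , inj₂ x~z  =
      step (root l) (inj₁ z) x (proj₂ (from (root-trace l z) z∈Pl)) x∉Ω
           (subst T (MAdj-sym adj-sym x (inj₁ z)) x~z)

    component-isUnion : ∀ l → IsComponentUnion M Ω (component l)
    component-isUnion l = (λ _ x∈C → proj₁ (toWitness x∈C)) , closed
      where
      closed : ∀ x y → T (component l x) → T (M x y) → Ω y ≡ false → T (component l y)
      closed x y x∈C x~y y∉Ω with MAdj-cover vc x y x~y
      ... | inj₁ (z , refl , z∈Vk) =
        component-intro l y∉Ω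
          (z , to (root-trace l z) (z∈Vk , component-reached l x∈C) , inj₂ (subst T (MAdj-sym adj-sym x y) x~y))
      ... | inj₂ (z , refl , z∈Vk) =
        component-intro l y∉Ω
          (z , to (root-trace l z) (z∈Vk , step (root l) x y (component-reached l x∈C) y∉Ω x~y) , inj₁ refl)

    neighbour-in-A-or-reached : ∀ {v} → ¬ InVk v → Ω v ≡ false → ∀ z → T (M v (inj₁ z)) →
                                z ∈ A ⊎ (Ω (inj₁ z) ≡ false × z ∈ Vk × Reach M Ω v (inj₁ z))
    neighbour-in-A-or-reached {v} v∉Vk v∉Ω z v~z with Ω (inj₁ z) in z∈?Ω
    ... | true  = inj₁ (PartitionIs-Vk∩Ω⊆A pt (neighbour-∈Vk v∉Vk z v~z) (subst T (sym z∈?Ω) tt))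
    ... | false = inj₂ (refl , neighbour-∈Vk v∉Vk z v~z , step v v (inj₁ z) (here v v∉Ω) z∈?Ω v~z)

    neighbours-in-one-part : ∀ {v} → ¬ InVk v → Ω v ≡ false → ∃[ l ] NeighboursIn v (P l)
    neighbours-in-one-part {v} v∉Vk v∉Ω
      with Fin.any? (λ z → T? (M v (inj₁ z)) ×-dec (Ω (inj₁ z) Bool.≟ false))
    ... | no no-outside-neighbour = zero , all-in-A
      where
      all-in-A : NeighboursIn v (P zero)
      all-in-A z v~z with neighbour-in-A-or-reached v∉Vk v∉Ω z v~z
      ... | inj₁ z∈A       = inj₁ z∈A
      ... | inj₂ (z∉Ω , _) = ⊥-elim (no-outside-neighbour (z , v~z , z∉Ω))
    ... | yes (z , v~z , z∉Ω)
      with PartitionIs-trace pt v v∉Ω (z , neighbour-∈Vk v∉Vk z v~z , step v v (inj₁ z) (here v v∉Ω) z∉Ω v~z)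
    ...   | l , trace = l , in-A-or-Pl
      where
      in-A-or-Pl : NeighboursIn v (P l)
      in-A-or-Pl z' v~z' with neighbour-in-A-or-reached v∉Vk v∉Ω z' v~z'
      ... | inj₁ z'∈A               = inj₁ z'∈A
      ... | inj₂ (_ , z'∈Vk , v⇝z') = inj₂ (to (trace z') (z'∈Vk , v⇝z'))

  module _ {Ω : VSet V} (pt : PartitionIs adj Vk Ω A P₁ P₂ P₃) {H : Rel V}
           (minimal : IsMinimalTriangulation M H) (clique : IsClique H Ω) where

    ¬neighbours-in-one-part : ∀ {v} l → T (Ω v) → ¬ InVk v → ¬ NeighboursIn v (P l)
    ¬neighbours-in-one-part {v} l v∈Ω v∉Vk v-nbrs =
      separated-clique-pair-⊥ _≟M_ (MAdj-sym adj-sym) minimal clique v∈Ω (otherMarker-∈Ω pt l) v≢w v≁w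
        (component-isUnion pt l) v-nbrs⊆C w-nbrs∩C≡∅
      where
      w = otherMarker l

      v≢w : v ≢ w
      v≢w v≡w with representative l zero
      ... | a , a∈X , a∈Pj with subst (λ u → NeighboursIn u (P l)) v≡w v-nbrs a (∈⇒T-lookup a∈X)
      ...   | inj₁ a∈A  = disjoint-A (punchIn l zero) a∈A a∈Pj
      ...   | inj₂ a∈Pl = otherParts-∉part l a∈X a∈Pl

      v≁w : M v w ≡ false
      v≁w with M v w in v~?w
      ... | true  = ⊥-elim (v∉Vk (adjacent-to-marker⇒InVk vc v _ (subst T (sym v~?w) tt)))
      ... | false = refl

      v-nbrs⊆C : ∀ y → T (M v y) → Ω y ≡ false → T (component pt l y)
      v-nbrs⊆C y v~y y∉Ω with MAdj-cover vc v y v~y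
      ... | inj₁ v∈Vk = ⊥-elim (v∉Vk v∈Vk)
      ... | inj₂ (z , refl , _) with v-nbrs z v~y
      ...   | inj₁ z∈A  = ⊥-elim (subst T y∉Ω (PartitionIs-A⊆Ω pt z∈A))
      ...   | inj₂ z∈Pl = component-intro pt l y∉Ω (z , z∈Pl , inj₁ refl)

      w-nbrs∩C≡∅ : ∀ y → T (M w y) → ¬ T (component pt l y)
      w-nbrs∩C≡∅ (inj₁ z) w~z z∈C =
        otherParts-∉part l z∈X (to (root-trace pt l z) (otherParts-⊆Vk l z∈X , component-reached pt l z∈C))
        where z∈X = T-lookup⇒∈ w~z

  same-partition⇒⊆ : ∀ {Ω Ω' : VSet V} → IsPMC M Ω →
                     PartitionIs adj Vk Ω A P₁ P₂ P₃ → PartitionIs adj Vk Ω' A P₁ P₂ P₃ → Ω ⊆V Ω'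
  same-partition⇒⊆ {Ω} {Ω'} (H , minimal , clique , _) pt pt' v v∈Ω with InVk? v
  ... | yes (z , refl , z∈Vk) = PartitionIs-A⊆Ω pt' (PartitionIs-Vk∩Ω⊆A pt z∈Vk v∈Ω)
  ... | no v∉Vk with Ω' v in v∈?Ω'
  ...   | true  = tt
  ...   | false with neighbours-in-one-part pt' v∉Vk v∈?Ω'
  ...     | l , v-nbrs = ⊥-elim (¬neighbours-in-one-part pt minimal clique l v∈Ω v∉Vk v-nbrs)

lemma8 : (n k : ℕ) (adj : Fin n → Fin n → Bool) → IsSimple adj →
         (Vk : Subset n) → IsVertexCover adj Vk → ∣ Vk ∣ ≡ k →
         (A P₁ P₂ P₃ : Subset n) → IsPartition4 Vk A P₁ P₂ P₃ →
         (Ω Ω' : VSet (MVertex n Vk)) →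
         IsPMC (MAdj adj Vk) Ω → IsFree (MAdj adj Vk) Ω → PartitionIs adj Vk Ω A P₁ P₂ P₃ →
         IsPMC (MAdj adj Vk) Ω' → IsFree (MAdj adj Vk) Ω' → PartitionIs adj Vk Ω' A P₁ P₂ P₃ →
         ∀ v → Ω v ≡ Ω' v
lemma8 n k adj (adj-sym , _) Vk vc _ A P₁ P₂ P₃ partition Ω Ω' pmc _ pt pmc' _ pt' =
  ⊆V-antisym (same-partition⇒⊆ adj-sym vc partition pmc pt pt')
             (same-partition⇒⊆ adj-sym vc partition pmc' pt' pt)
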